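{- Let $Z$ be a set and $\mathcal{Y}\subseteq\mathcal{P}(Z)$ containing all singletons, closed under finite unions and arbitrary intersections. Let $\mu:\mathcal{Y}\to\mathcal{Y}$ satisfy: $(\mu=)$ for finite sets, $(\mu\in)$, $(\mu PR3)$ and $(\mu\emptyset fin)$. Then, with $\mu_3$ as defined below, for all $X\in\mathcal{Y}$: (1) $\mu_3(X)\subseteq\mu(X)$; (2) if $X$ is finite, $\mu(X)=\mu_3(X)$; (3) $\mu_3$ satisfies $(\mu\subseteq)$; (4) $\mu_3$ satisfies $(\mu PR)$; (5) $\mu_3$ satisfies $(\mu\emptyset fin)$; (6) $\mu_3$ satisfies $(\mu=)$; (7) $\mu_3$ satisfies $(\mu\in)$; (8) $\mu(X)=\overbrace{\mu_3(X)}$.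
   Context: For $A\subseteq Z$, $\overbrace{A}:=\bigcap\{X\in\mathcal{Y}:A\subseteq X\}$. For $B\in\mathcal{Y}$ and $A\subseteq B$, $A$ is a small subset of $B$ iff there is no $X\in\mathcal{Y}$ with $B-A\subseteq X\subsetneq B$. Write $\mu(x,y):=\mu(\{x,y\})$. For $U\in\mathcal{Y}$, $\mu_3(U):=\{x\in U:\forall y\in U.\,x\in\mu(\{x,y\})\}$. Conditions, for a function $f$ (either $\mu$ or $\mu_3$) on $\mathcal{Y}$ and sets in $\mathcal{Y}$: $(\mu\subseteq)$ $f(X)\subseteq X$; $(\mu PR)$ $X\subseteq Y\Rightarrow f(Y)\cap X\subseteq f(X)$; $(\mu=)$ $X\subseteq Y$, $f(Y)\cap X\neq\emptyset\Rightarrow f(Y)\cap X=f(X)$ ("for finite sets": only for finite $X,Y$); $(\mu\emptyset fin)$ $X$ finite and nonempty $\Rightarrow f(X)\neq\emptyset$; $(\mu\in)$ $a\in X-f(X)\Rightarrow\exists b\in X.\,a\notin f(\{a,b\})$. $(\mu PR3)$: for every $U\in\mathcal{Y}$, $\mu(U)-\mu_3(U)$ is a small subset of $\mu(U)$. -}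

module Defs where

open import Level using (0ℓ) renaming (suc to lsuc)
open import Data.Product using (Σ; ∃; _×_; _,_)
open import Data.Sum using (_⊎_)
open import Data.List using (List)
open import Data.List.Membership.Propositional using () renaming (_∈_ to _∈ₗ_)
open import Relation.Nullary using (¬_)
open import Relation.Binary.PropositionalEquality using (_≡_)
open import Relation.Unary using (Pred; _∈_; _∉_; _⊆_; _≐_; _∩_; _∪_; Satisfiable)
open import Function.Bundles using (_⇔_)

-- Subsets of Z are predicates Z → Set; a "system" 𝒴 ⊆ 𝒫(Z) is a predicate on them.
Subset : Set → Set₁
Subset Z = Pred Z 0ℓ

System : Set → Set₂
System Z = Pred (Subset Z) (lsuc 0ℓ)

module _ {Z : Set} where

  sing : Z → Subset Z
  sing x z = z ≡ x

  pair : Z → Z → Subset Z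
  pair x y z = (z ≡ x) ⊎ (z ≡ y)

  _∖_ : Subset Z → Subset Z → Subset Z
  (A ∖ B) z = z ∈ A × z ∉ B

  Finite : Subset Z → Set
  Finite X = ∃ λ (xs : List Z) → ∀ z → (z ∈ X) ⇔ (z ∈ₗ xs)

  _⊊_ : Subset Z → Subset Z → Set
  X ⊊ B = X ⊆ B × ¬ (B ⊆ X)

  Hat : System Z → Subset Z → Pred Z (lsuc 0ℓ)
  Hat 𝒴 A z = ∀ X → 𝒴 X → A ⊆ X → z ∈ X

  Small : System Z → Subset Z → Subset Z → Set₁
  Small 𝒴 A B = A ⊆ B × ¬ (∃ λ X → 𝒴 X × (B ∖ A) ⊆ X × X ⊊ B)

  -- structural assumptions on 𝒴
  -- 𝒴 is closed under extensional equality of subsets (sets are extensional)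
  Ext𝒴 : System Z → Set₁
  Ext𝒴 𝒴 = ∀ X Y → X ≐ Y → 𝒴 X → 𝒴 Y

  HasSingletons : System Z → Set₁
  HasSingletons 𝒴 = ∀ x → 𝒴 (sing x)

  UnionClosed : System Z → Set₁
  UnionClosed 𝒴 = ∀ X Y → 𝒴 X → 𝒴 Y → 𝒴 (X ∪ Y)

  InterClosed : System Z → Set₂
  InterClosed 𝒴 = ∀ (𝓕 : Pred (Subset Z) (lsuc 0ℓ)) → (∀ X → 𝓕 X → 𝒴 X) →
    ∃ λ I → 𝒴 I × (∀ z → (z ∈ I) ⇔ (∀ X → 𝓕 X → z ∈ X))

  -- μ : 𝒴 → 𝒴 (μ is only constrained on arguments in 𝒴)
  MapsInto : System Z → (Subset Z → Subset Z) → Set₁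
  MapsInto 𝒴 μ = ∀ X → 𝒴 X → 𝒴 (μ X)

  ExtFun : System Z → (Subset Z → Subset Z) → Set₁
  ExtFun 𝒴 μ = ∀ X Y → 𝒴 X → 𝒴 Y → X ≐ Y → μ X ≐ μ Y

  μ₃ : (Subset Z → Subset Z) → Subset Z → Subset Z
  μ₃ μ U x = x ∈ U × (∀ y → y ∈ U → x ∈ μ (pair x y))

  Cond-⊆ : System Z → (Subset Z → Subset Z) → Set₁
  Cond-⊆ 𝒴 f = ∀ X → 𝒴 X → f X ⊆ X

  Cond-PR : System Z → (Subset Z → Subset Z) → Set₁
  Cond-PR 𝒴 f = ∀ X Y → 𝒴 X → 𝒴 Y → X ⊆ Y → (f Y ∩ X) ⊆ f X

  Cond-= : System Z → (Subset Z → Subset Z) → Set₁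
  Cond-= 𝒴 f = ∀ X Y → 𝒴 X → 𝒴 Y → X ⊆ Y →
    Satisfiable (f Y ∩ X) → (f Y ∩ X) ≐ f X

  Cond-=fin : System Z → (Subset Z → Subset Z) → Set₁
  Cond-=fin 𝒴 f = ∀ X Y → 𝒴 X → 𝒴 Y → Finite X → Finite Y → X ⊆ Y →
    Satisfiable (f Y ∩ X) → (f Y ∩ X) ≐ f X

  Cond-∅fin : System Z → (Subset Z → Subset Z) → Set₁
  Cond-∅fin 𝒴 f = ∀ X → 𝒴 X → Finite X → Satisfiable X → Satisfiable (f X)

  Cond-∈ : System Z → (Subset Z → Subset Z) → Set₁
  Cond-∈ 𝒴 f = ∀ X a → 𝒴 X → a ∈ X → a ∉ f X →
    ∃ λ b → b ∈ X × a ∉ f (pair a b)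

  Cond-PR3 : System Z → (Subset Z → Subset Z) → Set₁
  Cond-PR3 𝒴 μ = ∀ U → 𝒴 U → Small 𝒴 (μ U ∖ μ₃ μ U) (μ U)

{-# OPTIONS --safe #-}
-- On finite sets (μ=) says that μ is determined by its values on pairs, and that
-- preference on pairs is transitive: μ{x,y,z} is nonempty, and (μ=) on the pairs
-- inside {x,y,z} pushes any of its points back to x. This gives (2), (5) and (6).
-- For arbitrary U, if X ∈ 𝒴 contains μ₃(U) then μ(U) ∩ X ∈ 𝒴 lies between
-- μ(U) − (μ(U) − μ₃(U)) and μ(U); smallness of μ(U) − μ₃(U) forces it to be all
-- of μ(U). So μ(U) is the 𝒴-hull of μ₃(U), which gives (8) and (μ⊆) for μ.
module Submission where

open import Defs
open import Level using (0ℓ) renaming (suc to lsuc)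
open import Data.Product using (_×_; _,_; proj₁; proj₂; ∃)
open import Data.Sum using (_⊎_; inj₁; inj₂)
open import Data.Empty using (⊥-elim)
open import Data.List using ([]; _∷_)
open import Data.List.Relation.Unary.Any using (here; there)
open import Relation.Nullary.Decidable using (yes; no; decidable-stable)
open import Relation.Binary.PropositionalEquality using (_≡_; refl)
open import Relation.Unary using (_⊆_; _≐_; _∩_; _∪_; _∈_; _∉_)
open import Function.Bundles using (mk⇔; Equivalence)
open import Axiom.ExcludedMiddle using (ExcludedMiddle)

module _ {Z : Set} where

  triple : Z → Z → Z → Subset Z
  triple x y z = pair x y ∪ sing z

  pair-finite : (x y : Z) → Finite (pair x y)
  pair-finite x y = x ∷ y ∷ [] , λ _ → mk⇔
    (λ { (inj₁ refl) → here refl ; (inj₂ refl) → there (here refl) })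
    (λ { (here refl) → inj₁ refl ; (there (here refl)) → inj₂ refl ; (there (there ())) })

  triple-finite : (x y z : Z) → Finite (triple x y z)
  triple-finite x y z = x ∷ y ∷ z ∷ [] , λ _ → mk⇔
    (λ { (inj₁ (inj₁ refl)) → here refl
       ; (inj₁ (inj₂ refl)) → there (here refl)
       ; (inj₂ refl) → there (there (here refl)) })
    (λ { (here refl) → inj₁ (inj₁ refl)
       ; (there (here refl)) → inj₁ (inj₂ refl)
       ; (there (there (here refl))) → inj₂ refl
       ; (there (there (there ()))) })

  pair⊆ : ∀ {X : Subset Z} {a b} → a ∈ X → b ∈ X → pair a b ⊆ X
  pair⊆ a∈X _ (inj₁ refl) = a∈X
  pair⊆ _ b∈X (inj₂ refl) = b∈X

  PairTransitive : (Subset Z → Subset Z) → Set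
  PairTransitive f = ∀ {x y z} → x ∈ f (pair x z) → z ∈ f (pair z y) → x ∈ f (pair x y)

module _ {Z : Set} {𝒴 : System Z} where

  pair-∈ : HasSingletons 𝒴 → UnionClosed 𝒴 → ∀ x y → 𝒴 (pair x y)
  pair-∈ sg un x y = un (sing x) (sing y) (sg x) (sg y)

  triple-∈ : HasSingletons 𝒴 → UnionClosed 𝒴 → ∀ x y z → 𝒴 (triple x y z)
  triple-∈ sg un x y z = un (pair x y) (sing z) (pair-∈ sg un x y) (sg z)

  ∩-closed : Ext𝒴 𝒴 → InterClosed 𝒴 → ∀ {X Y} → 𝒴 X → 𝒴 Y → 𝒴 (X ∩ Y)
  ∩-closed ext ic {X} {Y} 𝒴X 𝒴Y with ic (λ W → W ≡ X ⊎ W ≡ Y) (λ { _ (inj₁ refl) → 𝒴X ; _ (inj₂ refl) → 𝒴Y })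
  ... | I , 𝒴I , I≐⋂ = ext I (X ∩ Y) (I⊆X∩Y , X∩Y⊆I) 𝒴I
    where
    I⊆X∩Y : I ⊆ X ∩ Y
    I⊆X∩Y {w} w∈I = Equivalence.to (I≐⋂ w) w∈I X (inj₁ refl) , Equivalence.to (I≐⋂ w) w∈I Y (inj₂ refl)
    X∩Y⊆I : X ∩ Y ⊆ I
    X∩Y⊆I {w} (w∈X , w∈Y) = Equivalence.from (I≐⋂ w) λ { _ (inj₁ refl) → w∈X ; _ (inj₂ refl) → w∈Y }

  μ₃-⊆ : ∀ f → Cond-⊆ 𝒴 (μ₃ f)
  μ₃-⊆ _ _ _ = proj₁

  μ₃-PR : ∀ f → Cond-PR 𝒴 (μ₃ f)
  μ₃-PR _ _ _ _ _ X⊆Y ((_ , x≻Y) , x∈X) = x∈X , λ y y∈X → x≻Y y (X⊆Y y∈X)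

  μ₃-= : ∀ f → PairTransitive f → Cond-= 𝒴 (μ₃ f)
  μ₃-= f trans X Y 𝒴X 𝒴Y X⊆Y (z , (_ , z≻Y) , z∈X) = μ₃-PR f X Y 𝒴X 𝒴Y X⊆Y , extend
    where
    extend : μ₃ f X ⊆ μ₃ f Y ∩ X
    extend (x∈X , x≻X) = (X⊆Y x∈X , λ y y∈Y → trans (x≻X z z∈X) (z≻Y y y∈Y)) , x∈X

  μ₃-∈ : ExcludedMiddle 0ℓ → ∀ f → Cond-∈ 𝒴 (μ₃ f)
  μ₃-∈ em f X a _ a∈X a∉μ₃X with em {∃ λ b → b ∈ X × a ∉ f (pair a b)}
  ... | yes (b , b∈X , a∉fab) = b , b∈X , λ a∈μ₃ → a∉fab (proj₂ a∈μ₃ b (inj₂ refl))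
  ... | no ∄b = ⊥-elim (a∉μ₃X (a∈X , λ y y∈X → decidable-stable em λ a∉fay → ∄b (y , y∈X , a∉fay)))

  μ₃⊆ : ExcludedMiddle 0ℓ → ∀ {f} → Cond-∈ 𝒴 f → ∀ X → 𝒴 X → μ₃ f X ⊆ f X
  μ₃⊆ em f-∈ X 𝒴X (x∈X , x≻X) = decidable-stable em λ x∉fX →
    let b , b∈X , x∉fxb = f-∈ X _ 𝒴X x∈X x∉fX in x∉fxb (x≻X b b∈X)

  module _ (sg : HasSingletons 𝒴) (un : UnionClosed 𝒴) {f : Subset Z → Subset Z}
           (f-=fin : Cond-=fin 𝒴 f) where

    pair-restrict : ∀ {Y a b} → 𝒴 Y → Finite Y → a ∈ Y → b ∈ Y → a ∈ f Y → a ∈ f (pair a b)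
    pair-restrict {Y} {a} {b} 𝒴Y finY a∈Y b∈Y a∈fY =
      proj₁ (f-=fin (pair a b) Y (pair-∈ sg un a b) 𝒴Y (pair-finite a b) finY (pair⊆ a∈Y b∈Y) (a , a∈fY , inj₁ refl))
        (a∈fY , inj₁ refl)

    pair-extend : ∀ {Y a b} → 𝒴 Y → Finite Y → a ∈ Y → b ∈ Y → b ∈ f Y → a ∈ f (pair a b) → a ∈ f Y
    pair-extend {Y} {a} {b} 𝒴Y finY a∈Y b∈Y b∈fY a∈fab =
      proj₁ (proj₂ (f-=fin (pair a b) Y (pair-∈ sg un a b) 𝒴Y (pair-finite a b) finY (pair⊆ a∈Y b∈Y) (b , b∈fY , inj₂ refl))
        a∈fab)

    pair-transitive : Cond-⊆ 𝒴 f → Cond-∅fin 𝒴 f → PairTransitive f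
    pair-transitive f-⊆ f-∅fin {x} {y} {z} x≻z z≻y = pair-restrict 𝒴T finT x∈T y∈T x∈fT
      where
      T : Subset Z
      T = triple x y z
      𝒴T : 𝒴 T
      𝒴T = triple-∈ sg un x y z
      finT : Finite T
      finT = triple-finite x y z
      x∈T : x ∈ T
      x∈T = inj₁ (inj₁ refl)
      y∈T : y ∈ T
      y∈T = inj₁ (inj₂ refl)
      z∈T : z ∈ T
      z∈T = inj₂ refl
      z∈fT⇒x∈fT : z ∈ f T → x ∈ f T
      z∈fT⇒x∈fT z∈fT = pair-extend 𝒴T finT x∈T z∈T z∈fT x≻z
      x∈fT : x ∈ f T
      x∈fT with f-∅fin T 𝒴T finT (x , x∈T)
      ... | w , w∈fT with f-⊆ T 𝒴T w∈fT
      ... | inj₁ (inj₁ refl) = w∈fT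
      ... | inj₁ (inj₂ refl) = z∈fT⇒x∈fT (pair-extend 𝒴T finT z∈T y∈T w∈fT z≻y)
      ... | inj₂ refl = z∈fT⇒x∈fT w∈fT

    ⊆μ₃-fin : Cond-⊆ 𝒴 f → ∀ X → 𝒴 X → Finite X → f X ⊆ μ₃ f X
    ⊆μ₃-fin f-⊆ X 𝒴X finX x∈fX = x∈X , λ y y∈X → pair-restrict 𝒴X finX x∈X y∈X x∈fX
      where
      x∈X : _ ∈ X
      x∈X = f-⊆ X 𝒴X x∈fX

    μ₃-∅fin : Cond-⊆ 𝒴 f → Cond-∅fin 𝒴 f → Cond-∅fin 𝒴 (μ₃ f)
    μ₃-∅fin f-⊆ f-∅fin X 𝒴X finX X≠∅ =
      let w , w∈fX = f-∅fin X 𝒴X finX X≠∅ in w , ⊆μ₃-fin f-⊆ X 𝒴X finX w∈fX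

  module _ (em : ExcludedMiddle 0ℓ) (ext : Ext𝒴 𝒴) (ic : InterClosed 𝒴) where

    small-⊆ : ∀ {A B X} → Small 𝒴 A B → 𝒴 B → 𝒴 X → B ∖ A ⊆ X → B ⊆ X
    small-⊆ {A} {B} {X} (_ , no-gap) 𝒴B 𝒴X B∖A⊆X = λ w∈B → proj₂ (B⊆B∩X w∈B)
      where
      B⊆B∩X : B ⊆ B ∩ X
      B⊆B∩X = decidable-stable (em {B ⊆ B ∩ X}) λ B⊈B∩X →
        no-gap (B ∩ X , ∩-closed ext ic 𝒴B 𝒴X , (λ w∈B∖A → proj₁ w∈B∖A , B∖A⊆X w∈B∖A) , proj₁ , B⊈B∩X)

    module _ {μ : Subset Z → Subset Z} (mi : MapsInto 𝒴 μ) (μ-PR3 : Cond-PR3 𝒴 μ) where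

      μ⊆Hat-μ₃ : ∀ U → 𝒴 U → μ U ⊆ Hat 𝒴 (μ₃ μ U)
      μ⊆Hat-μ₃ U 𝒴U w∈μU X 𝒴X μ₃U⊆X = small-⊆ (μ-PR3 U 𝒴U) (mi U 𝒴U) 𝒴X μU∖[μU∖μ₃U]⊆X w∈μU
        where
        μU∖[μU∖μ₃U]⊆X : μ U ∖ (μ U ∖ μ₃ μ U) ⊆ X
        μU∖[μU∖μ₃U]⊆X (v∈μU , v∉μU∖μ₃U) =
          μ₃U⊆X (decidable-stable em λ v∉μ₃U → v∉μU∖μ₃U (v∈μU , v∉μ₃U))

      PR3⇒μ-⊆ : Cond-⊆ 𝒴 μ
      PR3⇒μ-⊆ U 𝒴U w∈μU = μ⊆Hat-μ₃ U 𝒴U w∈μU U 𝒴U proj₁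

-- Excluded middle for propositions in Set suffices.
fact4p13 : ExcludedMiddle 0ℓ → ExcludedMiddle (lsuc 0ℓ) →
    (Z : Set) (𝒴 : System Z) (μ : Subset Z → Subset Z) →
    Ext𝒴 𝒴 → HasSingletons 𝒴 → UnionClosed 𝒴 → InterClosed 𝒴 →
    MapsInto 𝒴 μ → ExtFun 𝒴 μ →
    Cond-=fin 𝒴 μ → Cond-∈ 𝒴 μ → Cond-PR3 𝒴 μ → Cond-∅fin 𝒴 μ →
    (∀ X → 𝒴 X → μ₃ μ X ⊆ μ X)
    × (∀ X → 𝒴 X → Finite X → μ X ≐ μ₃ μ X)
    × Cond-⊆ 𝒴 (μ₃ μ)
    × Cond-PR 𝒴 (μ₃ μ)
    × Cond-∅fin 𝒴 (μ₃ μ)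
    × Cond-= 𝒴 (μ₃ μ)
    × Cond-∈ 𝒴 (μ₃ μ)
    × (∀ X → 𝒴 X → μ X ≐ Hat 𝒴 (μ₃ μ X))
fact4p13 em _ Z 𝒴 μ ext sg un ic mi _ μ-=fin μ-∈ μ-PR3 μ-∅fin =
    μ₃⊆μ
  , (λ X 𝒴X finX → ⊆μ₃-fin sg un μ-=fin μ-⊆ X 𝒴X finX , μ₃⊆μ X 𝒴X)
  , μ₃-⊆ μ
  , μ₃-PR μ
  , μ₃-∅fin sg un μ-=fin μ-⊆ μ-∅fin
  , μ₃-= μ (pair-transitive sg un μ-=fin μ-⊆ μ-∅fin)
  , μ₃-∈ em μ
  , λ X 𝒴X → μ⊆Hat-μ₃ em ext ic mi μ-PR3 X 𝒴X , λ X⊆Hat → X⊆Hat (μ X) (mi X 𝒴X) (μ₃⊆μ X 𝒴X)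
  where
  μ₃⊆μ : ∀ X → 𝒴 X → μ₃ μ X ⊆ μ X
  μ₃⊆μ = μ₃⊆ em μ-∈

  μ-⊆ : Cond-⊆ 𝒴 μ
  μ-⊆ = PR3⇒μ-⊆ em ext ic mi μ-PR3
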